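{- Let $n\geq 4$ and let $a,b$ be positive integers with $2b<a$. Then the sequence $(h_0,\ldots,h_n)\in \mathbb{Z}_{>0}^{n+1}$ with $h_0=1$, $h_1=\cdots=h_{n-1}=a$ and $h_n=b$ is not a pure $O$-sequence.
   Context: Monomials are in finitely many indeterminates $x_1,\ldots,x_s$ (any $s$), each of degree $1$. An order ideal of monomials is a nonempty finite set $\mathcal{A}$ of monomials such that whenever $u\in\mathcal{A}$ and $v$ is a monomial dividing $u$, then $v\in\mathcal{A}$. It is pure if all its maximal elements with respect to divisibility have the same degree. Its $h$-vector is $h(\mathcal{A})=(h_0,\ldots,h_n)$ where $n=\max\{\deg u: u\in\mathcal{A}\}$ and $h_i$ is the number of elements of $\mathcal{A}$ of degree $i$. A finite sequence of positive integers is a pure $O$-sequence if it equals $h(\mathcal{A})$ for some pure order ideal of monomials $\mathcal{A}$. -}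

module Defs where

open import Data.Nat using (ℕ; zero; suc; _≤_; _⊔_)
open import Data.Nat.Properties using (_≟_)
open import Data.Vec using (Vec)
import Data.Vec as V
open import Data.Vec.Relation.Binary.Pointwise.Inductive using (Pointwise)
open import Data.List using (List; []; _∷_; map; filter; length; foldr; upTo)
open import Data.List.Membership.Propositional using (_∈_)
open import Data.List.Relation.Unary.Unique.Propositional using (Unique)
open import Data.Product using (Σ; ∃; _×_; _,_)
open import Relation.Binary.PropositionalEquality using (_≡_; _≢_)

-- A monomial in the indeterminates x_1,…,x_s is its exponent vector.
Monomial : ℕ → Set
Monomial s = Vec ℕ s

deg : ∀ {s} → Monomial s → ℕ
deg = V.sum

_∣ₘ_ : ∀ {s} → Monomial s → Monomial s → Set
v ∣ₘ u = Pointwise _≤_ v u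

-- A finite set of monomials is represented by a duplicate-free list.
-- Order ideal: nonempty, finite, closed under divisors.
record IsOrderIdeal {s : ℕ} (A : List (Monomial s)) : Set where
  field
    unique   : Unique A
    nonempty : A ≢ []
    closed   : ∀ u v → u ∈ A → v ∣ₘ u → v ∈ A

IsMaximal : ∀ {s} → List (Monomial s) → Monomial s → Set
IsMaximal A u = u ∈ A × (∀ w → w ∈ A → u ∣ₘ w → w ≡ u)

IsPure : ∀ {s} → List (Monomial s) → Set
IsPure A = ∀ u w → IsMaximal A u → IsMaximal A w → deg u ≡ deg w

maxDeg : ∀ {s} → List (Monomial s) → ℕ
maxDeg A = foldr _⊔_ 0 (map deg A)

countDeg : ∀ {s} → List (Monomial s) → ℕ → ℕ
countDeg A i = length (filter (λ u → deg u ≟ i) A)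

hVector : ∀ {s} → List (Monomial s) → List ℕ
hVector A = map (countDeg A) (upTo (suc (maxDeg A)))

IsPureOSequence : List ℕ → Set
IsPureOSequence h =
  Σ ℕ λ s → Σ (List (Monomial s)) λ A →
    IsOrderIdeal A × IsPure A × hVector A ≡ h

module Submission where

-- A charging argument. Let A be a pure order ideal with top degree N ≥ 4 and let x be a variable
-- of A. Choose a maximal monomial m divisible by x; by purity deg m = N. If m has k variables, the
-- degree-2 divisors x·y of m lie in A and their x-exponents add up to (k − 1) + 2·[x² ∣ m]; call
-- the amount by which this falls short of 4 the charge of m to x. Summing the x-exponents over
-- the degree-2 part of A gives 4 h₁ ≤ 2 h₂ + Σ_{deg m = N} Σ_x charge m x, and a finite case check
-- shows Σ_x charge m x ≤ 4 whenever deg m ≥ 4. Hence 4 h₁ ≤ 2 h₂ + 4 h_N, so h₁ = h₂ = a and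
-- h_N = b force a ≤ 2b.

open import Data.Bool using (true; false; if_then_else_)
open import Data.Empty using (⊥-elim)
open import Data.Fin using (Fin; zero; suc; punchIn) renaming (_≟_ to _≟ᶠ_)
open import Data.Fin.Properties using (punchInᵢ≢i)
open import Data.List using (List; []; _∷_; _++_; _∷ʳ_; length; map; filter; tabulate; allFin; replicate; applyUpTo)
open import Data.List.Membership.Propositional using (_∈_; find; lose)
open import Data.List.Membership.Propositional.Properties using (∈-map⁻; ∈-filter⁻; ∈-filter⁺)
open import Data.List.Properties using (∷-injective; ∷ʳ-injective; applyUpTo-∷ʳ; length-applyUpTo; length-replicate; map-upTo)
open import Data.List.Relation.Binary.Subset.Propositional using (_⊆_)
open import Data.List.Relation.Unary.All using (All; []; _∷_)
import Data.List.Relation.Unary.All as All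
open import Data.List.Relation.Unary.All.Properties using (all-filter)
open import Data.List.Relation.Unary.AllPairs using ([]; _∷_)
open import Data.List.Relation.Unary.Any using (here; there; any?; _─_)
open import Data.List.Relation.Unary.Unique.Propositional using (Unique)
open import Data.List.Relation.Unary.Unique.Propositional.Properties using (map⁺; filter⁺; allFin⁺)
open import Data.Nat using (ℕ; zero; suc; _+_; _*_; _∸_; _≤_; _<_; z≤n; s≤s)
open import Data.Nat.Properties
open import Data.Product using (∃-syntax; _×_; _,_; proj₁; proj₂)
open import Data.Sum using (inj₁; inj₂)
open import Data.Vec using ([]; _∷_; lookup)
import Data.Vec as Vec
open import Data.Vec.Properties using (≡-dec; lookup∘tabulate)
import Data.Vec.Relation.Binary.Pointwise.Inductive as Pointwise
open import Function using (_∘_)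
open import Level using (0ℓ)
open import Relation.Binary.PropositionalEquality
open import Relation.Nullary using (¬_; does; yes; no)
open import Relation.Nullary.Decidable using (_×-dec_; ¬?; decidable-stable)
open import Relation.Unary using (Pred; Decidable)

open import Algebra.Properties.CommutativeSemigroup +-commutativeSemigroup using (x∙yz≈y∙xz)
open import Algebra.Properties.Semiring.Sum +-*-semiring
  using (sum; sum-syntax; ∑-distrib-+; *-distribˡ-sum; *-distribʳ-sum; sum-cong-≗; sum-remove; sum-replicate-zero)

open import Defs

∑-mono-≤ : ∀ {n} {f g : Fin n → ℕ} → (∀ i → f i ≤ g i) → sum f ≤ sum g
∑-mono-≤ {zero}  f≤g = z≤n
∑-mono-≤ {suc n} f≤g = +-mono-≤ (f≤g zero) (∑-mono-≤ (f≤g ∘ suc))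

term≤∑ : ∀ {n} (f : Fin n → ℕ) i → f i ≤ sum f
term≤∑ {suc n} f i = ≤-trans (m≤m+n (f i) _) (≤-reflexive (sym (sum-remove {i = i} f)))

∑-supported : ∀ {n} (f : Fin n → ℕ) i → (∀ j → j ≢ i → f j ≡ 0) → sum f ≡ f i
∑-supported {suc n} f i off = begin
  sum f                       ≡⟨ sum-remove {i = i} f ⟩
  f i + sum (f ∘ punchIn i)   ≡⟨ cong (f i +_) (sum-cong-≗ {n} (λ j → off _ (punchInᵢ≢i i j))) ⟩
  f i + sum {n} (λ _ → 0)     ≡⟨ cong (f i +_) (sum-replicate-zero n) ⟩
  f i + 0                     ≡⟨ +-identityʳ (f i) ⟩
  f i                         ∎
  where open ≡-Reasoning

≡suc⇒1≤ : ∀ {v k} → v ≡ suc k → 1 ≤ v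
≡suc⇒1≤ refl = s≤s z≤n

sumOver : ∀ {A : Set} → List A → (A → ℕ) → ℕ
sumOver []       f = 0
sumOver (x ∷ xs) f = f x + sumOver xs f

infixl 10 sumOver
syntax sumOver L (λ q → e) = ∑[ q ∈ L ] e

sumOver-member : ∀ {A : Set} (f : A → ℕ) {x : A} {L} → x ∈ L → f x ≤ ∑[ q ∈ L ] f q
sumOver-member f (here refl)             = m≤m+n _ _
sumOver-member f {L = y ∷ L} (there x∈L) = ≤-trans (sumOver-member f x∈L) (m≤n+m _ (f y))

sumOver-const : ∀ {A : Set} (f : A → ℕ) c {L : List A} → All (λ q → f q ≡ c) L →
                ∑[ q ∈ L ] f q ≡ c * length L
sumOver-const f c []                    = sym (*-zeroʳ c)
sumOver-const f c {_ ∷ L} (fq≡c ∷ fL≡c) =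
  trans (cong₂ _+_ fq≡c (sumOver-const f c fL≡c)) (sym (*-suc c (length L)))

sumOver-≤-const : ∀ {A : Set} (f : A → ℕ) c {L : List A} → All (λ q → f q ≤ c) L →
                  ∑[ q ∈ L ] f q ≤ c * length L
sumOver-≤-const f c []                    = z≤n
sumOver-≤-const f c {_ ∷ L} (fq≤c ∷ fL≤c) =
  ≤-trans (+-mono-≤ fq≤c (sumOver-≤-const f c fL≤c)) (≤-reflexive (sym (*-suc c (length L))))

sumOver-positive : ∀ {A : Set} (f : A → ℕ) (L : List A) → 1 ≤ ∑[ q ∈ L ] f q → ∃[ q ] q ∈ L × 1 ≤ f q
sumOver-positive f (q ∷ L) pos with f q in eq
... | zero  = let (r , r∈L , 1≤fr) = sumOver-positive f L pos in r , there r∈L , 1≤fr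
... | suc _ = q , here refl , ≡suc⇒1≤ eq

nonempty⇒∃∈ : ∀ {A : Set} {L : List A} → 1 ≤ length L → ∃[ x ] x ∈ L
nonempty⇒∃∈ {L = x ∷ _} _ = x , here refl

sumOver-map : ∀ {A B : Set} (h : A → B) (f : B → ℕ) (L : List A) →
              ∑[ q ∈ map h L ] f q ≡ ∑[ p ∈ L ] f (h p)
sumOver-map h f []      = refl
sumOver-map h f (p ∷ L) = cong (f (h p) +_) (sumOver-map h f L)

sumOver-filter : ∀ {A : Set} {P : Pred A 0ℓ} (P? : Decidable P) (f : A → ℕ) (L : List A) →
                 ∑[ q ∈ filter P? L ] f q ≡ ∑[ q ∈ L ] (if does (P? q) then f q else 0)
sumOver-filter P? f []      = refl
sumOver-filter P? f (q ∷ L) with does (P? q)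
... | true  = cong (f q +_) (sumOver-filter P? f L)
... | false = sumOver-filter P? f L

sumOver-tabulate : ∀ {A : Set} {n} (g : Fin n → A) (f : A → ℕ) → ∑[ q ∈ tabulate g ] f q ≡ ∑[ i < n ] f (g i)
sumOver-tabulate {n = zero}  g f = refl
sumOver-tabulate {n = suc n} g f = cong (f (g zero) +_) (sumOver-tabulate (g ∘ suc) f)

sumOver-map-filter-allFin : ∀ {A : Set} {n} (h : Fin n → A) {P : Pred (Fin n) 0ℓ} (P? : Decidable P)
                            (f : A → ℕ) → ∑[ q ∈ map h (filter P? (allFin n)) ] f q
                                        ≡ ∑[ i < n ] (if does (P? i) then f (h i) else 0)
sumOver-map-filter-allFin {n = n} h P? f = begin
  ∑[ q ∈ map h (filter P? (allFin n)) ] f q   ≡⟨ sumOver-map h f (filter P? (allFin n)) ⟩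
  ∑[ i ∈ filter P? (allFin n) ] f (h i)       ≡⟨ sumOver-filter P? (f ∘ h) (allFin n) ⟩
  ∑[ i ∈ allFin n ] g i                       ≡⟨ sumOver-tabulate (λ i → i) g ⟩
  ∑[ i < n ] g i                              ∎
  where
  open ≡-Reasoning
  g : Fin n → ℕ
  g i = if does (P? i) then f (h i) else 0

∑-sumOver-comm : ∀ {A : Set} {n} (F : A → Fin n → ℕ) (L : List A) →
                 ∑[ i < n ] ∑[ q ∈ L ] F q i ≡ ∑[ q ∈ L ] ∑[ i < n ] F q i
∑-sumOver-comm {n = n} F []      = sum-replicate-zero n
∑-sumOver-comm         F (q ∷ L) =
  trans (∑-distrib-+ (F q) _) (cong (sum (F q) +_) (∑-sumOver-comm F L))

sumOver-─ : ∀ {A : Set} (f : A → ℕ) {x : A} {L} (x∈L : x ∈ L) →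
            ∑[ q ∈ L ] f q ≡ f x + ∑[ q ∈ L ─ x∈L ] f q
sumOver-─ f (here refl) = refl
sumOver-─ f {x} {y ∷ L} (there x∈L) =
  trans (cong (f y +_) (sumOver-─ f x∈L)) (x∙yz≈y∙xz (f y) (f x) (∑[ q ∈ L ─ x∈L ] f q))

∈-─ : ∀ {A : Set} {x y : A} {L} (x∈L : x ∈ L) → y ∈ L → y ≢ x → y ∈ (L ─ x∈L)
∈-─ (here refl)  (here refl)  y≢x = ⊥-elim (y≢x refl)
∈-─ (here refl)  (there y∈L)  y≢x = y∈L
∈-─ (there x∈L)  (here refl)  y≢x = here refl
∈-─ (there x∈L)  (there y∈L)  y≢x = there (∈-─ x∈L y∈L y≢x)

sumOver-mono-⊆ : ∀ {A : Set} (f : A → ℕ) {K L : List A} → Unique K → K ⊆ L →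
                 ∑[ q ∈ K ] f q ≤ ∑[ q ∈ L ] f q
sumOver-mono-⊆ f {[]}        _          _   = z≤n
sumOver-mono-⊆ f {k ∷ K} {L} (k∉K ∷ uK) K⊆L = begin
  f k + ∑[ q ∈ K ] f q           ≤⟨ +-monoʳ-≤ (f k) (sumOver-mono-⊆ f uK K⊆L─k) ⟩
  f k + ∑[ q ∈ L ─ k∈L ] f q     ≡⟨ sumOver-─ f k∈L ⟨
  ∑[ q ∈ L ] f q                 ∎
  where
  open ≤-Reasoning
  k∈L = K⊆L (here refl)
  K⊆L─k : K ⊆ (L ─ k∈L)
  K⊆L─k q∈K = ∈-─ k∈L (K⊆L (there q∈K)) (λ q≡k → All.lookup k∉K q∈K (sym q≡k))

deg≡∑lookup : ∀ {s} (u : Monomial s) → deg u ≡ ∑[ i < s ] lookup u i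
deg≡∑lookup []      = refl
deg≡∑lookup (e ∷ u) = cong (e +_) (deg≡∑lookup u)

lookup≤deg : ∀ {s} (u : Monomial s) i → lookup u i ≤ deg u
lookup≤deg u i = ≤-trans (term≤∑ (lookup u) i) (≤-reflexive (sym (deg≡∑lookup u)))

lookup⇒∣ₘ : ∀ {s} {v u : Monomial s} → (∀ i → lookup v i ≤ lookup u i) → v ∣ₘ u
lookup⇒∣ₘ {v = []}    {[]}    _   = Pointwise.[]
lookup⇒∣ₘ {v = _ ∷ _} {_ ∷ _} v≤u = v≤u zero Pointwise.∷ lookup⇒∣ₘ (v≤u ∘ suc)

∣ₘ⇒deg≤ : ∀ {s} {v u : Monomial s} → v ∣ₘ u → deg v ≤ deg u
∣ₘ⇒deg≤ Pointwise.[]          = z≤n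
∣ₘ⇒deg≤ (e≤f Pointwise.∷ v∣u) = +-mono-≤ e≤f (∣ₘ⇒deg≤ v∣u)

∣ₘ∧deg≡⇒≡ : ∀ {s} {v u : Monomial s} → v ∣ₘ u → deg v ≡ deg u → v ≡ u
∣ₘ∧deg≡⇒≡ Pointwise.[] _ = refl
∣ₘ∧deg≡⇒≡ {v = e ∷ v} (e≤f Pointwise.∷ v∣u) deg≡ with m≤n⇒m<n∨m≡n e≤f
... | inj₁ e<f  = ⊥-elim (<⇒≢ (+-mono-<-≤ e<f (∣ₘ⇒deg≤ v∣u)) deg≡)
... | inj₂ refl = cong (e ∷_) (∣ₘ∧deg≡⇒≡ v∣u (+-cancelˡ-≡ e _ _ deg≡))

∣ₘ∧≢⇒deg< : ∀ {s} {v u : Monomial s} → v ∣ₘ u → v ≢ u → deg v < deg u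
∣ₘ∧≢⇒deg< v∣u v≢u with m≤n⇒m<n∨m≡n (∣ₘ⇒deg≤ v∣u)
... | inj₁ deg< = deg<
... | inj₂ deg≡ = ⊥-elim (v≢u (∣ₘ∧deg≡⇒≡ v∣u deg≡))

deg≤maxDeg : ∀ {s} {A : List (Monomial s)} {u} → u ∈ A → deg u ≤ maxDeg A
deg≤maxDeg (here refl)             = m≤m⊔n _ _
deg≤maxDeg {A = v ∷ _} (there u∈A) = m≤n⇒m≤o⊔n (deg v) (deg≤maxDeg u∈A)

maxDeg-maximal : ∀ {s} {A : List (Monomial s)} {u} → u ∈ A → deg u ≡ maxDeg A → IsMaximal A u
maxDeg-maximal u∈A deg≡max = u∈A , λ w w∈A u∣w →
  sym (∣ₘ∧deg≡⇒≡ u∣w (≤-antisym (∣ₘ⇒deg≤ u∣w) (≤-trans (deg≤maxDeg w∈A) (≤-reflexive (sym deg≡max)))))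

maximal-above : ∀ {s} (A : List (Monomial s)) {u} → u ∈ A → ∃[ w ] IsMaximal A w × u ∣ₘ w
maximal-above {s} A u∈A = climb (suc (maxDeg A)) u∈A (m≤n+m _ _)
  where
  climb : ∀ fuel {u} → u ∈ A → maxDeg A < deg u + fuel → ∃[ w ] IsMaximal A w × u ∣ₘ w
  climb zero {u} u∈A max< =
    ⊥-elim (<⇒≱ max< (≤-trans (≤-reflexive (+-identityʳ (deg u))) (deg≤maxDeg u∈A)))
  climb (suc fuel) {u} u∈A max< with any? (λ w → Pointwise.decidable _≤?_ u w ×-dec ¬? (≡-dec _≟_ w u)) A
  ... | yes ∃multiple with (w , w∈A , u∣w , w≢u) ← find ∃multiple =
    let (w′ , w′-max , w∣w′) = climb fuel w∈A (≤-trans max< (≤-trans (≤-reflexive (+-suc (deg u) fuel))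
                                 (+-monoˡ-≤ fuel (∣ₘ∧≢⇒deg< u∣w (w≢u ∘ sym)))))
    in w′ , w′-max , Pointwise.trans ≤-trans u∣w w∣w′
  ... | no ∄multiple = u , (u∈A , λ w w∈A u∣w →
          decidable-stable (≡-dec _≟_ w u) (λ w≢u → ∄multiple (lose w∈A (u∣w , w≢u)))) , Pointwise.refl ≤-refl

occurs simple repeated : ℕ → ℕ
occurs zero    = 0
occurs (suc _) = 1
simple 1 = 1
simple _ = 0
repeated (suc (suc _)) = 1
repeated _             = 0

occurs≡simple+repeated : ∀ v → occurs v ≡ simple v + repeated v
occurs≡simple+repeated 0             = refl
occurs≡simple+repeated 1             = refl
occurs≡simple+repeated (suc (suc _)) = refl

exponent≤simple+repeated* : ∀ {v d} → v ≤ d → v ≤ simple v + repeated v * d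
exponent≤simple+repeated* {0}           _   = z≤n
exponent≤simple+repeated* {1}           _   = ≤-refl
exponent≤simple+repeated* {suc (suc _)} v≤d = ≤-trans v≤d (≤-reflexive (sym (+-identityʳ _)))

support : ∀ {s} → Monomial s → ℕ
support {s} m = ∑[ y < s ] occurs (lookup m y)

-- k is the number of variables of a monomial m and v ≥ 1 the exponent of x in m.
quadraticWeight deficit : ℕ → ℕ → ℕ
quadraticWeight k v = 2 * repeated v + (k ∸ 1)
deficit k v = occurs v * (4 ∸ quadraticWeight k v)

charge : ∀ {s} → Monomial s → Fin s → ℕ
charge m x = deficit (support m) (lookup m x)

4≤quadraticWeight+deficit : ∀ k {v} → 1 ≤ v → 4 ≤ quadraticWeight k v + deficit k v
4≤quadraticWeight+deficit k {suc v} _ = ≤-trans (m≤n+m∸n 4 w) (≤-reflexive (cong (w +_) (sym (+-identityʳ (4 ∸ w)))))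
  where w = quadraticWeight k (suc v)

deficit≡ : ∀ k v → deficit k v ≡ simple v * (4 ∸ (k ∸ 1)) + repeated v * (4 ∸ (2 + (k ∸ 1)))
deficit≡ k 0             = refl
deficit≡ k 1             = sym (+-identityʳ _)
deficit≡ k (suc (suc _)) = refl

-- c₁ and c₂ count the variables of exponent 1 and of exponent ≥ 2 of a monomial.
deficit-table-≥5 : ∀ c₁ c₂ → 5 ≤ c₁ + c₂ →
                   c₁ * (4 ∸ (c₁ + c₂ ∸ 1)) + c₂ * (4 ∸ (2 + (c₁ + c₂ ∸ 1))) ≤ 4
deficit-table-≥5 c₁ c₂ 5≤k = ≤-trans (≤-reflexive (cong₂ _+_
    (trans (cong (c₁ *_) (m≤n⇒m∸n≡0 4≤k∸1)) (*-zeroʳ c₁))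
    (trans (cong (c₂ *_) (m≤n⇒m∸n≡0 (≤-trans 4≤k∸1 (m≤n+m _ 2)))) (*-zeroʳ c₂)))) z≤n
  where
  4≤k∸1 : 4 ≤ c₁ + c₂ ∸ 1
  4≤k∸1 = ∸-monoˡ-≤ 1 5≤k

deficit-table : ∀ c₁ c₂ → (c₂ ≡ 0 → 4 ≤ c₁) →
                c₁ * (4 ∸ (c₁ + c₂ ∸ 1)) + c₂ * (4 ∸ (2 + (c₁ + c₂ ∸ 1))) ≤ 4
deficit-table 0 0 h = ⊥-elim (<⇒≱ (≤ᵇ⇒≤ _ _ _) (h refl))
deficit-table 1 0 h = ⊥-elim (<⇒≱ (≤ᵇ⇒≤ _ _ _) (h refl))
deficit-table 2 0 h = ⊥-elim (<⇒≱ (≤ᵇ⇒≤ _ _ _) (h refl))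
deficit-table 3 0 h = ⊥-elim (<⇒≱ (≤ᵇ⇒≤ _ _ _) (h refl))
deficit-table 4 0 _ = ≤ᵇ⇒≤ _ _ _
deficit-table 0 1 _ = ≤ᵇ⇒≤ _ _ _
deficit-table 0 2 _ = ≤ᵇ⇒≤ _ _ _
deficit-table 0 3 _ = ≤ᵇ⇒≤ _ _ _
deficit-table 0 4 _ = ≤ᵇ⇒≤ _ _ _
deficit-table 1 1 _ = ≤ᵇ⇒≤ _ _ _
deficit-table 1 2 _ = ≤ᵇ⇒≤ _ _ _
deficit-table 1 3 _ = ≤ᵇ⇒≤ _ _ _
deficit-table 2 1 _ = ≤ᵇ⇒≤ _ _ _
deficit-table 2 2 _ = ≤ᵇ⇒≤ _ _ _
deficit-table 3 1 _ = ≤ᵇ⇒≤ _ _ _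
deficit-table 0 c₂@(suc (suc (suc (suc (suc _))))) _ = deficit-table-≥5 0 c₂ (≤ᵇ⇒≤ _ _ _)
deficit-table 1 c₂@(suc (suc (suc (suc _))))       _ = deficit-table-≥5 1 c₂ (≤ᵇ⇒≤ _ _ _)
deficit-table 2 c₂@(suc (suc (suc _)))             _ = deficit-table-≥5 2 c₂ (≤ᵇ⇒≤ _ _ _)
deficit-table 3 c₂@(suc (suc _))                   _ = deficit-table-≥5 3 c₂ (≤ᵇ⇒≤ _ _ _)
deficit-table 4 c₂@(suc _)                         _ = deficit-table-≥5 4 c₂ (≤ᵇ⇒≤ _ _ _)
deficit-table c₁@(suc (suc (suc (suc (suc _))))) c₂ _ = deficit-table-≥5 c₁ c₂ (≤ᵇ⇒≤ _ _ _)

∑-charge≤4 : ∀ {s} (m : Monomial s) → 4 ≤ deg m → ∑[ x < s ] charge m x ≤ 4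
∑-charge≤4 {s} m 4≤deg = begin
  ∑[ x < s ] charge m x
    ≡⟨ sum-cong-≗ (deficit≡ (support m) ∘ lookup m) ⟩
  ∑[ x < s ] (simple (lookup m x) * α + repeated (lookup m x) * β)
    ≡⟨ ∑-distrib-+ (λ x → simple (lookup m x) * α) (λ x → repeated (lookup m x) * β) ⟩
  ∑[ x < s ] (simple (lookup m x) * α) + ∑[ x < s ] (repeated (lookup m x) * β)
    ≡⟨ cong₂ _+_ (*-distribʳ-sum α (simple ∘ lookup m)) (*-distribʳ-sum β (repeated ∘ lookup m)) ⟨
  c₁ * α + c₂ * β
    ≡⟨ cong (λ k → c₁ * (4 ∸ (k ∸ 1)) + c₂ * (4 ∸ (2 + (k ∸ 1)))) support≡c₁+c₂ ⟩
  c₁ * (4 ∸ (c₁ + c₂ ∸ 1)) + c₂ * (4 ∸ (2 + (c₁ + c₂ ∸ 1)))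
    ≤⟨ deficit-table c₁ c₂ c₂≡0⇒4≤c₁ ⟩
  4 ∎
  where
  open ≤-Reasoning
  α β c₁ c₂ : ℕ
  α  = 4 ∸ (support m ∸ 1)
  β  = 4 ∸ (2 + (support m ∸ 1))
  c₁ = ∑[ x < s ] simple (lookup m x)
  c₂ = ∑[ x < s ] repeated (lookup m x)
  support≡c₁+c₂ : support m ≡ c₁ + c₂
  support≡c₁+c₂ =
    trans (sum-cong-≗ (occurs≡simple+repeated ∘ lookup m)) (∑-distrib-+ (simple ∘ lookup m) (repeated ∘ lookup m))
  deg≤c₁+c₂*deg : deg m ≤ c₁ + c₂ * deg m
  deg≤c₁+c₂*deg = begin
    deg m
      ≡⟨ deg≡∑lookup m ⟩
    ∑[ x < s ] lookup m x
      ≤⟨ ∑-mono-≤ (λ x → exponent≤simple+repeated* (lookup≤deg m x)) ⟩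
    ∑[ x < s ] (simple (lookup m x) + repeated (lookup m x) * deg m)
      ≡⟨ ∑-distrib-+ (simple ∘ lookup m) (λ x → repeated (lookup m x) * deg m) ⟩
    c₁ + ∑[ x < s ] (repeated (lookup m x) * deg m)
      ≡⟨ cong (c₁ +_) (*-distribʳ-sum (deg m) (repeated ∘ lookup m)) ⟨
    c₁ + c₂ * deg m ∎
  c₂≡0⇒4≤c₁ : c₂ ≡ 0 → 4 ≤ c₁
  c₂≡0⇒4≤c₁ c₂≡0 = ≤-trans 4≤deg (≤-trans deg≤c₁+c₂*deg
    (≤-reflexive (trans (cong (λ c → c₁ + c * deg m) c₂≡0) (+-identityʳ c₁))))

δ : ∀ {s} → Fin s → Fin s → ℕ
δ i j = if does (i ≟ᶠ j) then 1 else 0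

δ-refl : ∀ {s} (i : Fin s) → δ i i ≡ 1
δ-refl i with i ≟ᶠ i
... | yes _   = refl
... | no i≢i = ⊥-elim (i≢i refl)

δ-≢ : ∀ {s} {i j : Fin s} → i ≢ j → δ i j ≡ 0
δ-≢ {i = i} {j} i≢j with i ≟ᶠ j
... | yes i≡j = ⊥-elim (i≢j i≡j)
... | no _    = refl

∑-δ : ∀ {s} (x : Fin s) → ∑[ z < s ] δ z x ≡ 1
∑-δ x = trans (∑-supported (λ z → δ z x) x (λ _ → δ-≢)) (δ-refl x)

deg-tabulate : ∀ {s} (f : Fin s → ℕ) → deg (Vec.tabulate f) ≡ ∑[ i < s ] f i
deg-tabulate {s} f = trans (deg≡∑lookup (Vec.tabulate f)) (sum-cong-≗ {s} (lookup∘tabulate f))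

unit : ∀ {s} → Fin s → Monomial s
unit x = Vec.tabulate (λ z → δ z x)

pair : ∀ {s} → Fin s → Fin s → Monomial s
pair x y = Vec.tabulate (λ z → δ z x + δ z y)

deg-unit : ∀ {s} (x : Fin s) → deg (unit x) ≡ 1
deg-unit x = trans (deg-tabulate (λ z → δ z x)) (∑-δ x)

deg-pair : ∀ {s} (x y : Fin s) → deg (pair x y) ≡ 2
deg-pair x y = begin
  deg (pair x y)                        ≡⟨ deg-tabulate (λ z → δ z x + δ z y) ⟩
  ∑[ z < _ ] (δ z x + δ z y)            ≡⟨ ∑-distrib-+ (λ z → δ z x) (λ z → δ z y) ⟩
  ∑[ z < _ ] δ z x + ∑[ z < _ ] δ z y   ≡⟨ cong₂ _+_ (∑-δ x) (∑-δ y) ⟩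
  2                                     ∎
  where open ≡-Reasoning

unit-unique : ∀ {s} {u : Monomial s} x → deg u ≡ 1 → 1 ≤ lookup u x → u ≡ unit x
unit-unique {u = u} x deg≡1 1≤uₓ =
  sym (∣ₘ∧deg≡⇒≡ (lookup⇒∣ₘ unit≤u) (trans (deg-unit x) (sym deg≡1)))
  where
  unit≤u : ∀ z → lookup (unit x) z ≤ lookup u z
  unit≤u z rewrite lookup∘tabulate (λ z → δ z x) z with z ≟ᶠ x
  ... | yes refl = 1≤uₓ
  ... | no _     = z≤n

lookup-pair-left : ∀ {s} (x y : Fin s) → lookup (pair x y) x ≡ 1 + δ x y
lookup-pair-left x y = trans (lookup∘tabulate (λ z → δ z x + δ z y) x) (cong (_+ δ x y) (δ-refl x))

pair-injective : ∀ {s} (x : Fin s) {y y′} → pair x y ≡ pair x y′ → y ≡ y′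
pair-injective x {y} {y′} xy≡xy′ with y ≟ᶠ y′
... | yes y≡y′ = y≡y′
... | no y≢y′  = ⊥-elim (0≢1+n (begin
  0                             ≡⟨ δ-≢ y≢y′ ⟨
  δ y y′                        ≡⟨ +-cancelˡ-≡ (δ y x) _ _ (begin
     δ y x + δ y y′                ≡⟨ lookup∘tabulate (λ z → δ z x + δ z y′) y ⟨
     lookup (pair x y′) y          ≡⟨ cong (λ q → lookup q y) xy≡xy′ ⟨
     lookup (pair x y) y           ≡⟨ lookup∘tabulate (λ z → δ z x + δ z y) y ⟩
     δ y x + δ y y                 ∎) ⟩
  δ y y                         ≡⟨ δ-refl y ⟩
  1                             ∎))
  where open ≡-Reasoning

pair-∣ₘ : ∀ {s} {m : Monomial s} {x y} → 1 ≤ lookup m x → 1 + δ x y ≤ lookup m y → pair x y ∣ₘ m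
pair-∣ₘ {m = m} {x} {y} 1≤mₓ 1+δ≤m_y = lookup⇒∣ₘ pair≤m
  where
  pair≤m : ∀ z → lookup (pair x y) z ≤ lookup m z
  pair≤m z rewrite lookup∘tabulate (λ z → δ z x + δ z y) z with z ≟ᶠ x | z ≟ᶠ y
  ... | yes refl | yes refl = subst (λ d → 1 + d ≤ lookup m z) (δ-refl z) 1+δ≤m_y
  ... | yes refl | no _     = 1≤mₓ
  ... | no _     | yes refl = ≤-trans (s≤s z≤n) 1+δ≤m_y
  ... | no _     | no _     = z≤n

occurs-pos : ∀ {v} → 1 ≤ v → occurs v ≡ 1
occurs-pos {suc _} _ = refl

[1≤?]≡occurs : ∀ v → (if does (1 ≤? v) then 1 else 0) ≡ occurs v
[1≤?]≡occurs zero    = refl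
[1≤?]≡occurs (suc _) = refl

[2≤?]≡2*repeated : ∀ v → (if does (2 ≤? v) then 2 else 0) ≡ 2 * repeated v
[2≤?]≡2*repeated 0             = refl
[2≤?]≡2*repeated 1             = refl
[2≤?]≡2*repeated (suc (suc _)) = refl

-- Once x occurs in m, x·y divides m exactly when its y-exponent 1 + δ x y does.
quadraticDivisors : ∀ {s} → Monomial s → Fin s → List (Monomial s)
quadraticDivisors {s} m x = map (pair x) (filter (λ y → 1 + δ x y ≤? lookup m y) (allFin s))

quadraticDivisors-unique : ∀ {s} (m : Monomial s) x → Unique (quadraticDivisors m x)
quadraticDivisors-unique {s} m x = map⁺ (pair-injective x) (filter⁺ (λ y → 1 + δ x y ≤? lookup m y) (allFin⁺ s))

∈-quadraticDivisors : ∀ {s} {m : Monomial s} {x q} → 1 ≤ lookup m x → q ∈ quadraticDivisors m x →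
                      q ∣ₘ m × deg q ≡ 2
∈-quadraticDivisors {s} {m} {x} 1≤mₓ q∈ with (y , y∈ , refl) ← ∈-map⁻ (pair x) q∈ =
  pair-∣ₘ 1≤mₓ (proj₂ (∈-filter⁻ (λ y → 1 + δ x y ≤? lookup m y) {xs = allFin s} y∈)) , deg-pair x y

∑-quadraticDivisors : ∀ {s} (m : Monomial s) x → 1 ≤ lookup m x →
                      ∑[ q ∈ quadraticDivisors m x ] lookup q x ≡ quadraticWeight (support m) (lookup m x)
∑-quadraticDivisors {suc s} m x 1≤mₓ = begin
  ∑[ q ∈ quadraticDivisors m x ] lookup q x
    ≡⟨ sumOver-map-filter-allFin (pair x) P? (λ q → lookup q x) ⟩
  ∑[ y < suc s ] (if does (P? y) then lookup (pair x y) x else 0)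
    ≡⟨ sum-cong-≗ {suc s} (λ y → cong (λ e → if does (P? y) then e else 0) (lookup-pair-left x y)) ⟩
  ∑[ y < suc s ] weight y
    ≡⟨ sum-remove {i = x} weight ⟩
  weight x + ∑[ j < s ] weight (punchIn x j)
    ≡⟨ cong₂ _+_ weight-x (sum-cong-≗ {s} (λ j → weight-≢ (punchInᵢ≢i x j))) ⟩
  2 * repeated (lookup m x) + ∑[ j < s ] occurs (lookup m (punchIn x j))
    ≡⟨ cong (λ k → 2 * repeated (lookup m x) + (k ∸ 1)) support≡ ⟨
  quadraticWeight (support m) (lookup m x) ∎
  where
  open ≡-Reasoning
  P? = λ y → 1 + δ x y ≤? lookup m y
  weight : Fin (suc s) → ℕ
  weight y = if does (P? y) then 1 + δ x y else 0
  weight-x : weight x ≡ 2 * repeated (lookup m x)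
  weight-x = trans (cong (λ d → if does (1 + d ≤? lookup m x) then 1 + d else 0) (δ-refl x))
                   ([2≤?]≡2*repeated (lookup m x))
  weight-≢ : ∀ {y} → y ≢ x → weight y ≡ occurs (lookup m y)
  weight-≢ {y} y≢x = trans (cong (λ d → if does (1 + d ≤? lookup m y) then 1 + d else 0) (δ-≢ (y≢x ∘ sym)))
                           ([1≤?]≡occurs (lookup m y))
  support≡ : support m ≡ 1 + ∑[ j < s ] occurs (lookup m (punchIn x j))
  support≡ = trans (sum-remove {i = x} (occurs ∘ lookup m))
                   (cong (_+ ∑[ j < s ] occurs (lookup m (punchIn x j))) (occurs-pos 1≤mₓ))

layer : ∀ {s} → List (Monomial s) → ℕ → List (Monomial s)
layer A d = filter (λ u → deg u ≟ d) A

∈-layer⁻ : ∀ {s} {A : List (Monomial s)} {d u} → u ∈ layer A d → u ∈ A × deg u ≡ d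
∈-layer⁻ {A = A} {d} = ∈-filter⁻ (λ u → deg u ≟ d) {xs = A}

∈-layer⁺ : ∀ {s} {A : List (Monomial s)} {d u} → u ∈ A → deg u ≡ d → u ∈ layer A d
∈-layer⁺ {d = d} = ∈-filter⁺ (λ u → deg u ≟ d)

layer-deg : ∀ {s} (A : List (Monomial s)) d → All (λ u → deg u ≡ d) (layer A d)
layer-deg A d = all-filter (λ u → deg u ≟ d) A

layer-unique : ∀ {s} {A : List (Monomial s)} d → Unique A → Unique (layer A d)
layer-unique d = filter⁺ (λ u → deg u ≟ d)

column : ∀ {s} → List (Monomial s) → Fin s → ℕ
column L x = ∑[ q ∈ L ] lookup q x

∑-column : ∀ {s} {L : List (Monomial s)} d → All (λ q → deg q ≡ d) L → ∑[ x < s ] column L x ≡ d * length L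
∑-column {L = L} d degs≡d = trans (∑-sumOver-comm (λ q x → lookup q x) L)
  (sumOver-const (λ q → ∑[ x < _ ] lookup q x) d (All.map (λ {q} → trans (sym (deg≡∑lookup q))) degs≡d))

column-units≤1 : ∀ {s} (x : Fin s) {L : List (Monomial s)} → Unique L → All (λ u → deg u ≡ 1) L →
                 column L x ≤ 1
column-units≤1 x {[]}    _            _                = z≤n
column-units≤1 x {u ∷ L} (u∉L ∷ uniq) (deg≡1 ∷ degs≡1) with lookup u x in uₓ≡
... | zero  = column-units≤1 x uniq degs≡1
... | suc _ = +-mono-≤ (≤-trans (≤-reflexive (sym uₓ≡)) (≤-trans (lookup≤deg u x) (≤-reflexive deg≡1)))
                       (≤-reflexive (sumOver-const (λ q → lookup q x) 0 (All.tabulate x∉q)))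
  where
  x∉q : ∀ {q} → q ∈ L → lookup q x ≡ 0
  x∉q {q} q∈L with lookup q x in qₓ≡
  ... | zero  = refl
  ... | suc _ = ⊥-elim (All.lookup u∉L q∈L (trans (unit-unique x deg≡1 (≡suc⇒1≤ uₓ≡))
                                              (sym (unit-unique x (All.lookup degs≡1 q∈L) (≡suc⇒1≤ qₓ≡)))))

module _ {s} {A : List (Monomial s)} (ideal : IsOrderIdeal A) (pure : IsPure A)
         (top≢[] : 1 ≤ countDeg A (maxDeg A)) where
  open IsOrderIdeal ideal

  top : List (Monomial s)
  top = layer A (maxDeg A)

  below-top : ∀ {u} → u ∈ A → ∃[ m ] m ∈ top × u ∣ₘ m
  below-top u∈A =
    let (t , t∈top) = nonempty⇒∃∈ top≢[]
        (t∈A , deg-t) = ∈-layer⁻ t∈top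
        (w , w-max@(w∈A , _) , u∣w) = maximal-above A u∈A
    in w , ∈-layer⁺ w∈A (trans (pure w t w-max (maxDeg-maximal t∈A deg-t)) deg-t) , u∣w

  4≤column₂+charges : ∀ x {u} → u ∈ layer A 1 → 1 ≤ lookup u x → 4 ≤ column (layer A 2) x + ∑[ m ∈ top ] charge m x
  4≤column₂+charges x u∈layer₁ 1≤uₓ with (m , m∈top , u∣m) ← below-top (proj₁ (∈-layer⁻ u∈layer₁)) = begin
    4                                                       ≤⟨ 4≤quadraticWeight+deficit (support m) 1≤mₓ ⟩
    quadraticWeight (support m) (lookup m x) + charge m x   ≡⟨ cong (_+ charge m x) (∑-quadraticDivisors m x 1≤mₓ) ⟨
    ∑[ q ∈ quadraticDivisors m x ] lookup q x + charge m x  ≤⟨ +-mono-≤ divisors≤column₂ (sumOver-member (λ m′ → charge m′ x) m∈top) ⟩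
    column (layer A 2) x + ∑[ m ∈ top ] charge m x          ∎
    where
    open ≤-Reasoning
    1≤mₓ : 1 ≤ lookup m x
    1≤mₓ = ≤-trans 1≤uₓ (Pointwise.lookup u∣m x)
    divisors⊆layer₂ : quadraticDivisors m x ⊆ layer A 2
    divisors⊆layer₂ q∈ with (q∣m , deg-q) ← ∈-quadraticDivisors 1≤mₓ q∈ =
      ∈-layer⁺ (closed m _ (proj₁ (∈-layer⁻ m∈top)) q∣m) deg-q
    divisors≤column₂ : ∑[ q ∈ quadraticDivisors m x ] lookup q x ≤ column (layer A 2) x
    divisors≤column₂ = sumOver-mono-⊆ (λ q → lookup q x) (quadraticDivisors-unique m x) divisors⊆layer₂

  column-bound : ∀ x → 4 * column (layer A 1) x ≤ column (layer A 2) x + ∑[ m ∈ top ] charge m x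
  column-bound x with column (layer A 1) x in col≡ | column-units≤1 x (layer-unique 1 unique) (layer-deg A 1)
  ... | 0           | _      = z≤n
  ... | suc (suc _) | s≤s ()
  ... | 1           | _
    with (u , u∈layer₁ , 1≤uₓ) ← sumOver-positive (λ q → lookup q x) (layer A 1) (≤-reflexive (sym col≡)) =
    4≤column₂+charges x u∈layer₁ 1≤uₓ

  4h₁≤2h₂+4hₙ : 4 ≤ maxDeg A → 4 * countDeg A 1 ≤ 2 * countDeg A 2 + 4 * countDeg A (maxDeg A)
  4h₁≤2h₂+4hₙ 4≤N = begin
    4 * countDeg A 1
      ≡⟨ cong (4 *_) (trans (∑-column 1 (layer-deg A 1)) (*-identityˡ _)) ⟨
    4 * ∑[ x < s ] column (layer A 1) x
      ≡⟨ *-distribˡ-sum 4 (column (layer A 1)) ⟩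
    ∑[ x < s ] (4 * column (layer A 1) x)
      ≤⟨ ∑-mono-≤ column-bound ⟩
    ∑[ x < s ] (column (layer A 2) x + ∑[ m ∈ top ] charge m x)
      ≡⟨ ∑-distrib-+ (column (layer A 2)) (λ x → ∑[ m ∈ top ] charge m x) ⟩
    ∑[ x < s ] column (layer A 2) x + ∑[ x < s ] ∑[ m ∈ top ] charge m x
      ≡⟨ cong₂ _+_ (∑-column 2 (layer-deg A 2)) (∑-sumOver-comm charge top) ⟩
    2 * countDeg A 2 + ∑[ m ∈ top ] ∑[ x < s ] charge m x
      ≤⟨ +-monoʳ-≤ (2 * countDeg A 2) (sumOver-≤-const (λ m → ∑[ x < s ] charge m x) 4 (All.tabulate charges≤4)) ⟩
    2 * countDeg A 2 + 4 * countDeg A (maxDeg A) ∎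
    where
    open ≤-Reasoning
    charges≤4 : ∀ {m} → m ∈ top → ∑[ x < s ] charge m x ≤ 4
    charges≤4 {m} m∈top = ∑-charge≤4 m (≤-trans 4≤N (≤-reflexive (sym (proj₂ (∈-layer⁻ {A = A} m∈top)))))

applyUpTo-shape : ∀ (f : ℕ → ℕ) N {n a b} → applyUpTo f (suc N) ≡ (1 ∷ a ∷ a ∷ a ∷ replicate n a) ∷ʳ b →
                  N ≡ 4 + n × f 1 ≡ a × f 2 ≡ a × f N ≡ b
applyUpTo-shape f N {n} {a} eq with init≡ , fN≡b ← ∷ʳ-injective (applyUpTo f N) _ (trans (applyUpTo-∷ʳ f N) eq) =
  N≡4+n , proj₁ (∷-injective f₁…) , proj₁ (∷-injective (proj₂ (∷-injective f₁…))) , fN≡b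
  where
  N≡4+n : N ≡ 4 + n
  N≡4+n = trans (sym (length-applyUpTo f N)) (trans (cong length init≡) (cong (4 +_) (length-replicate n)))
  f₁… : applyUpTo (f ∘ suc) (3 + n) ≡ a ∷ a ∷ a ∷ replicate n a
  f₁… = proj₂ (∷-injective (subst (λ k → applyUpTo f k ≡ 1 ∷ a ∷ a ∷ a ∷ replicate n a) N≡4+n init≡))

4a≤2a+4b⇒a≤2b : ∀ {a b} → 4 * a ≤ 2 * a + 4 * b → a ≤ 2 * b
4a≤2a+4b⇒a≤2b {a} {b} 4a≤2a+4b = *-cancelˡ-≤ 2 (begin
  2 * a        ≤⟨ +-cancelˡ-≤ (2 * a) (2 * a) (4 * b) (≤-trans (≤-reflexive (sym (*-distribʳ-+ a 2 2))) 4a≤2a+4b) ⟩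
  4 * b        ≡⟨ *-assoc 2 2 b ⟩
  2 * (2 * b)  ∎)
  where open ≤-Reasoning

lemma1p3 : (n a b : ℕ) → 4 ≤ n → 1 ≤ a → 1 ≤ b → 2 * b < a →
    ¬ IsPureOSequence (1 ∷ replicate (n ∸ 1) a ++ b ∷ [])
lemma1p3 _ a b (s≤s (s≤s (s≤s (s≤s {n = n} _)))) _ 1≤b 2b<a (s , A , ideal , pure , hVector≡)
  with N≡4+n , h₁≡a , h₂≡a , hₙ≡b ←
         applyUpTo-shape (countDeg A) (maxDeg A) (trans (sym (map-upTo (countDeg A) (suc (maxDeg A)))) hVector≡) =
  <⇒≱ 2b<a (4a≤2a+4b⇒a≤2b {a} {b} (begin
    4 * a                                         ≡⟨ cong (4 *_) h₁≡a ⟨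
    4 * countDeg A 1                              ≤⟨ 4h₁≤2h₂+4hₙ ideal pure 1≤hₙ 4≤N ⟩
    2 * countDeg A 2 + 4 * countDeg A (maxDeg A)  ≡⟨ cong₂ (λ h₂ hₙ → 2 * h₂ + 4 * hₙ) h₂≡a hₙ≡b ⟩
    2 * a + 4 * b                                 ∎))
  where
  open ≤-Reasoning
  1≤hₙ : 1 ≤ countDeg A (maxDeg A)
  1≤hₙ = subst (1 ≤_) (sym hₙ≡b) 1≤b
  4≤N : 4 ≤ maxDeg A
  4≤N = ≤-trans (m≤m+n 4 n) (≤-reflexive (sym N≡4+n))
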